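{- Let $t\geq 4$ be a natural number and let $\Gamma$ be a finite group. Then $rc(CG(\Gamma))=t$ if and only if $\Gamma$ is nonabelian, has trivial center, and has exactly $t$ involutions that do not commute with any other nonidentity element of $\Gamma$.
   Context: For a finite group $\Gamma$, the commuting graph $CG(\Gamma)$ is the simple graph with vertex set $\Gamma$ in which two distinct elements $a,b$ are adjacent if and only if $ab=ba$. For a connected graph $G$, an edge coloring (adjacent edges may share colors) makes $G$ rainbow-connected if every two distinct vertices are joined by a path whose edges all have pairwise distinct colors; the rainbow connection number $rc(G)$ is the minimum number of colors in such a coloring. The center $Z(\Gamma)=\{z\in\Gamma: za=az \text{ for all } a\in\Gamma\}$ is trivial if it equals $\{e\}$. An involution is an element $a\neq e$ with $a^2=e$. -}

module Defs where

open import Data.Nat using (ℕ; suc; _<_)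
open import Data.Fin using (Fin; zero; suc; fromℕ; inject₁)
open import Data.Product using (Σ; _×_; ∃)
open import Relation.Binary.PropositionalEquality using (_≡_; _≢_)
open import Relation.Nullary using (¬_)
open import Algebra.Structures using (IsGroup)
open import Function.Definitions using (Injective)

-- A finite group, presented on the carrier Fin order (every finite group
-- is isomorphic to one of this form), with propositional equality.
record FiniteGroup : Set where
  field
    order   : ℕ
    _∙_     : Fin order → Fin order → Fin order
    ε       : Fin order
    _⁻¹     : Fin order → Fin order
    isGroup : IsGroup _≡_ _∙_ ε _⁻¹

module _ (Γ : FiniteGroup) where
  open FiniteGroup Γ

  CG : Fin order → Fin order → Set
  CG a b = (a ≢ b) × (a ∙ b ≡ b ∙ a)

  NonAbelian : Set
  NonAbelian = ¬ (∀ a b → a ∙ b ≡ b ∙ a)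

  TrivialCenter : Set
  TrivialCenter = ∀ z → (∀ a → z ∙ a ≡ a ∙ z) → z ≡ ε

  IsolatedInvolution : Fin order → Set
  IsolatedInvolution a =
    (a ≢ ε) × (a ∙ a ≡ ε) × (∀ b → b ≢ ε → b ≢ a → a ∙ b ≢ b ∙ a)

HasExactly : {n : ℕ} → ℕ → (Fin n → Set) → Set
HasExactly {n} t P =
  Σ (Fin t → Fin n) λ f →
    Injective _≡_ _≡_ f × (∀ i → P (f i)) × (∀ x → P x → ∃ λ i → f i ≡ x)

module _ {n : ℕ} (Adj : Fin n → Fin n → Set) where

  -- an edge colouring with (at most) k colours; colours on edges, so symmetric
  Coloring : ℕ → Set
  Coloring k = Σ (Fin n → Fin n → Fin k) λ c → ∀ a b → c a b ≡ c b a

  RainbowPath : {k : ℕ} → (Fin n → Fin n → Fin k) → Fin n → Fin n → Set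
  RainbowPath c u v =
    Σ ℕ λ m → Σ (Fin (suc m) → Fin n) λ p →
      (p zero ≡ u) × (p (fromℕ m) ≡ v) × Injective _≡_ _≡_ p ×
      (∀ (i : Fin m) → Adj (p (inject₁ i)) (p (suc i))) ×
      Injective _≡_ _≡_ (λ (i : Fin m) → c (p (inject₁ i)) (p (suc i)))

  RainbowConnected : {k : ℕ} → (Fin n → Fin n → Fin k) → Set
  RainbowConnected c = ∀ u v → u ≢ v → RainbowPath c u v

  RainbowColorable : ℕ → Set
  RainbowColorable k = Σ (Coloring k) λ c → RainbowConnected (Data.Product.proj₁ c)

  RCNumberIs : ℕ → Set
  RCNumberIs t = RainbowColorable t × (∀ k → k < t → ¬ RainbowColorable k)

{-# OPTIONS --safe #-}
module Submission where

-- In CG(Γ) the identity ε is adjacent to every other vertex, and the isolated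
-- involutions are exactly the leaves hanging off ε (u² commutes with u, so a
-- vertex whose only neighbour is ε is automatically an involution).
--
-- A rainbow path between two leaves must be leaf–ε–leaf, so the edges from ε
-- to the leaves all get different colours: rc ≥ #leaves.  Conversely, give
-- those edges distinct colours, every edge avoiding ε one extra colour, and
-- split the remaining vertices along a maximal independent set of CG(Γ) − ε,
-- colouring their edges to ε by side.  Every non-leaf then has a neighbour on
-- the other side, and any two non-adjacent vertices are joined by a rainbow
-- path of length at most 3.  So #leaves ≤ rc ≤ max(#leaves, 3), and for
-- t ≥ 4 we get rc = t exactly when there are t leaves.  Two leaves already
-- force Γ to be non-abelian with trivial centre.

open import Defs
open import Level using (0ℓ)
open import Data.Nat using (ℕ; zero; suc; _+_; _≤_; _⊔_; s≤s)
open import Data.Nat.Properties using (≤-refl; ≤-antisym; ≮⇒≥; <⇒≱; <⇒≤; ⊔-lub; m≤m⊔n; m≤n⊔m)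
open import Data.Fin using (Fin; zero; suc; _≟_; fromℕ; inject₁; inject≤)
open import Data.Fin.Properties using (all?; any?; ¬∀⟶∃¬; suc-injective; 0≢1+n; inject≤-injective; injective⇒≤)
open import Data.Bool using (Bool; true; false)
open import Data.Bool.Properties using (¬-not; not-¬) renaming (_≟_ to _≟ᵇ_)
open import Data.Vec using (Vec; []; _∷_; lookup)
import Data.Vec.Functional as Vector
open import Data.Vec.Relation.Unary.All using ([]; _∷_)
open import Data.Vec.Relation.Unary.AllPairs using ([]; _∷_)
open import Data.Vec.Relation.Unary.Linked using (Linked; [-]; _∷_)
open import Data.Vec.Relation.Unary.Unique.Propositional using (Unique)
open import Data.Vec.Relation.Unary.Unique.Propositional.Properties using (lookup-injective)
open import Data.Product using (_×_; _,_; ∃; ∃₂; proj₁; proj₂; map; map₂)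
open import Relation.Nullary using (¬_; Dec; yes; no; contradiction)
open import Relation.Nullary.Decidable using (_×-dec_; _→-dec_; ¬?; decidable-stable)
open import Relation.Binary.Definitions using (Symmetric; Decidable)
open import Relation.Binary.PropositionalEquality
  using (_≡_; _≢_; refl; sym; trans; cong; subst; ≢-sym; module ≡-Reasoning)
open import Function.Base using (id; _∘_)
open import Function.Definitions using (Injective)
open import Function.Bundles using (_⇔_; mk⇔; Equivalence)
open import Algebra.Bundles using (Group)
open import Algebra.Structures using (IsGroup)
import Algebra.Properties.Group as GroupProperties

count : ∀ {n} {P : Fin n → Set} → (∀ x → Dec (P x)) → ∃ λ p → HasExactly p P
count {zero} P? = 0 , (λ ()) , (λ { {()} }) , (λ ()) , (λ ())
count {suc n} {P} P? with count (λ x → P? (suc x)) | P? zero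
... | p , f , f-inj , f-P , f-onto | no ¬P0 =
  p , (λ i → suc (f i)) , (λ same → f-inj (suc-injective same)) , f-P , onto
  where
    onto : ∀ x → P x → ∃ λ i → suc (f i) ≡ x
    onto zero P0 = contradiction P0 ¬P0
    onto (suc x) Px = map₂ (cong suc) (f-onto x Px)
... | p , f , f-inj , f-P , f-onto | yes P0 = suc p , g , g-inj , g-P , onto
  where
    g : Fin (suc p) → Fin (suc n)
    g = zero Vector.∷ (λ i → suc (f i))
    g-inj : Injective _≡_ _≡_ g
    g-inj {zero} {zero} _ = refl
    g-inj {suc i} {suc j} same = cong suc (f-inj (suc-injective same))
    g-inj {zero} {suc _} ()
    g-inj {suc _} {zero} ()
    g-P : ∀ i → P (g i)
    g-P zero = P0
    g-P (suc i) = f-P i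
    onto : ∀ x → P x → ∃ λ i → g i ≡ x
    onto zero _ = zero , refl
    onto (suc x) Px = map suc (cong suc) (f-onto x Px)

HasExactly-cong : ∀ {n t} {P Q : Fin n → Set} →
  (∀ {x} → P x → Q x) → (∀ {x} → Q x → P x) → HasExactly t P → HasExactly t Q
HasExactly-cong P⇒Q Q⇒P (f , f-inj , f-P , f-onto) =
  f , f-inj , (λ i → P⇒Q (f-P i)) , (λ x Qx → f-onto x (Q⇒P Qx))

HasExactly⇒distinctPair : ∀ {n t} {P : Fin n → Set} →
  HasExactly (suc (suc t)) P → ∃₂ λ u v → P u × P v × u ≢ v
HasExactly⇒distinctPair (f , f-inj , f-P , _) =
  f zero , f (suc zero) , f-P zero , f-P (suc zero) , λ same → 0≢1+n (f-inj same)

record MaximalIndependentSet {n : ℕ} (R : Fin n → Fin n → Set) : Set where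
  field
    member      : Fin n → Bool
    independent : ∀ {a b} → R a b → member a ≡ true → member b ≡ false
    maximal     : ∀ {a} → member a ≡ false → ∃ λ b → R a b × member b ≡ true

open MaximalIndependentSet

-- Greedy construction: vertex 0 joins a maximal independent set of the
-- other vertices iff none of its neighbours is already in it.
maximalIndependentSet : ∀ {n} {R : Fin n → Fin n → Set} →
  Symmetric R → (∀ {a} → ¬ R a a) → Decidable R → MaximalIndependentSet R
maximalIndependentSet {zero} _ _ _ .member ()
maximalIndependentSet {zero} _ _ _ .independent {()}
maximalIndependentSet {zero} _ _ _ .maximal {()}
maximalIndependentSet {suc n} {R} R-sym R-irrefl R? =
  addZero (any? λ b → R? zero (suc b) ×-dec (member I b ≟ᵇ true))
  where
    I : MaximalIndependentSet (λ a b → R (suc a) (suc b))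
    I = maximalIndependentSet R-sym R-irrefl (λ a b → R? (suc a) (suc b))

    addZero : Dec (∃ λ b → R zero (suc b) × member I b ≡ true) → MaximalIndependentSet R
    addZero (yes _) .member = false Vector.∷ member I
    addZero (yes _) .independent {zero} _ ()
    addZero (yes _) .independent {suc _} {zero} _ _ = refl
    addZero (yes _) .independent {suc _} {suc _} r = independent I r
    addZero (yes (b , r , b∈I)) .maximal {zero} _ = suc b , r , b∈I
    addZero (yes _) .maximal {suc a} a∉I = map suc id (maximal I a∉I)
    addZero (no _) .member = true Vector.∷ member I
    addZero (no _) .independent {zero} {zero} r _ = contradiction r R-irrefl
    addZero (no none) .independent {zero} {suc b} r _ = ¬-not {y = true} λ b∈I → none (b , r , b∈I)
    addZero (no none) .independent {suc a} {zero} r a∈I = contradiction (a , R-sym r , a∈I) none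
    addZero (no _) .independent {suc _} {suc _} r = independent I r
    addZero (no _) .maximal {zero} ()
    addZero (no _) .maximal {suc a} a∉I = map suc id (maximal I a∉I)

edgeColours : ∀ {A B : Set} {m} → (A → A → B) → Vec A (suc m) → Vec B m
edgeColours c (x ∷ []) = []
edgeColours c (x ∷ y ∷ xs) = c x y ∷ edgeColours c (y ∷ xs)

lookup-edgeColours : ∀ {A B : Set} {m} (c : A → A → B) (xs : Vec A (suc m)) (i : Fin m) →
  lookup (edgeColours c xs) i ≡ c (lookup xs (inject₁ i)) (lookup xs (suc i))
lookup-edgeColours c (x ∷ y ∷ xs) zero = refl
lookup-edgeColours c (x ∷ y ∷ xs) (suc i) = lookup-edgeColours c (y ∷ xs) i

Linked-lookup : ∀ {A : Set} {R : A → A → Set} {m} {xs : Vec A (suc m)} →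
  Linked R xs → (i : Fin m) → R (lookup xs (inject₁ i)) (lookup xs (suc i))
Linked-lookup {xs = _ ∷ _ ∷ _} (r ∷ _) zero = r
Linked-lookup {xs = _ ∷ _ ∷ _} (_ ∷ rs) (suc i) = Linked-lookup rs i

walk⇒rainbowPath : ∀ {n k m} {Adj : Fin n → Fin n → Set}
  (c : Fin n → Fin n → Fin k) (xs : Vec (Fin n) (suc m)) →
  Unique xs → Linked Adj xs → Unique (edgeColours c xs) →
  RainbowPath Adj c (lookup xs zero) (lookup xs (fromℕ m))
walk⇒rainbowPath c xs distinct linked rainbow =
  _ , lookup xs , refl , refl , lookup-injective distinct _ _ , Linked-lookup linked ,
  λ {i} {j} same → lookup-injective rainbow i j
    (trans (lookup-edgeColours c xs i) (trans same (sym (lookup-edgeColours c xs j))))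

module Leaves {n : ℕ} (Adj : Fin n → Fin n → Set) (Adj-sym : Symmetric Adj) (hub : Fin n) where

  Leaf : Fin n → Set
  Leaf u = u ≢ hub × (∀ x → Adj u x → x ≡ hub)

  leaves-nonadjacent : ∀ {u v} → Leaf u → Leaf v → ¬ Adj u v
  leaves-nonadjacent (_ , u-leaf) (v≢hub , _) r = v≢hub (u-leaf _ r)

  dominating≡hub : ∀ {u v z} → Leaf u → Leaf v → u ≢ v → (∀ x → x ≢ z → Adj z x) → z ≡ hub
  dominating≡hub {u} {v} {z} (_ , u-leaf) (_ , v-leaf) u≢v dominating with z ≟ u
  ... | yes refl = v-leaf z (Adj-sym (dominating v (≢-sym u≢v)))
  ... | no z≢u = u-leaf z (Adj-sym (dominating u (≢-sym z≢u)))

  leaf-colours-differ : ∀ {k} (c : Fin n → Fin n → Fin k) {u v} → Leaf u → Leaf v → u ≢ v →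
    RainbowPath Adj c u v → c u hub ≢ c hub v
  leaf-colours-differ c _ _ u≢v (zero , p , refl , refl , _) _ = u≢v refl
  leaf-colours-differ c (_ , u-leaf) (v≢hub , _) _ (suc zero , p , refl , refl , _ , adj , _) _ =
    v≢hub (u-leaf _ (adj zero))
  leaf-colours-differ c (_ , u-leaf) (_ , v-leaf) _ (suc (suc m) , p , refl , refl , _ , adj , rainbow) same
    with rainbow {zero} {fromℕ (suc m)} (begin
      c (p zero) (p (suc zero))               ≡⟨ cong (c (p zero)) (u-leaf _ (adj zero)) ⟩
      c (p zero) hub                          ≡⟨ same ⟩
      c hub (p (suc (fromℕ (suc m))))         ≡⟨ cong (λ x → c x _) (sym (v-leaf _ (Adj-sym (adj (fromℕ (suc m)))))) ⟩
      c (p (inject₁ (fromℕ (suc m)))) (p (suc (fromℕ (suc m)))) ∎)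
    where open ≡-Reasoning
  ... | ()

  leaves≤colours : ∀ {p k} → HasExactly p Leaf → RainbowColorable Adj k → p ≤ k
  leaves≤colours (leaf , leaf-inj , isLeaf , _) ((c , c-sym) , connected) =
    injective⇒≤ {f = λ i → c hub (leaf i)} λ {i} {j} same →
      decidable-stable (i ≟ j) λ i≢j →
        let leaf-i≢leaf-j = λ e → i≢j (leaf-inj e) in
        leaf-colours-differ c (isLeaf i) (isLeaf j) leaf-i≢leaf-j
          (connected (leaf i) (leaf j) leaf-i≢leaf-j)
          (trans (c-sym (leaf i) hub) same)

≢-resp : ∀ {A : Set} {a a′ b b′ : A} → a ≡ a′ → b ≡ b′ → a′ ≢ b′ → a ≢ b
≢-resp refl refl a′≢b′ = a′≢b′

module DominatingVertex {n : ℕ} (Adj : Fin n → Fin n → Set) (Adj-sym : Symmetric Adj)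
  (Adj-irrefl : ∀ {a} → ¬ Adj a a) (Adj? : Decidable Adj)
  (hub : Fin n) (hub-dominates : ∀ u → u ≢ hub → Adj hub u) where

  open Leaves Adj Adj-sym hub

  adj⇒≢ : ∀ {a b} → Adj a b → a ≢ b
  adj⇒≢ r refl = Adj-irrefl r

  ¬adj⇒≢hub : ∀ {u v} → u ≢ v → ¬ Adj u v → u ≢ hub
  ¬adj⇒≢hub u≢v ¬r refl = ¬r (hub-dominates _ (≢-sym u≢v))

  Leaf? : ∀ u → Dec (Leaf u)
  Leaf? u = ¬? (u ≟ hub) ×-dec all? (λ x → Adj? u x →-dec x ≟ hub)

  OffHub : Fin n → Fin n → Set
  OffHub a b = a ≢ hub × b ≢ hub × Adj a b

  offHub⇒¬leaf : ∀ {v w} → OffHub v w → ¬ Leaf w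
  offHub⇒¬leaf (v≢hub , _ , r) (_ , w-leaf) = v≢hub (w-leaf _ (Adj-sym r))

  offHub-neighbour : ∀ {u} → u ≢ hub → ¬ Leaf u → ∃ (OffHub u)
  offHub-neighbour {u} u≢hub ¬leaf with ¬∀⟶∃¬ n _ (λ x → Adj? u x →-dec x ≟ hub) (λ all → ¬leaf (u≢hub , all))
  ... | w , ¬[r⇒w≡hub] =
    w , u≢hub , (λ w≡hub → ¬[r⇒w≡hub] λ _ → w≡hub) ,
    decidable-stable (Adj? u w) (λ ¬r → ¬[r⇒w≡hub] λ r → contradiction r ¬r)

  sides : MaximalIndependentSet OffHub
  sides = maximalIndependentSet
    (λ (a≢hub , b≢hub , r) → b≢hub , a≢hub , Adj-sym r)
    (λ (_ , _ , r) → Adj-irrefl r)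
    (λ a b → ¬? (a ≟ hub) ×-dec ¬? (b ≟ hub) ×-dec Adj? a b)

  other-side-neighbour : ∀ {u} → u ≢ hub → ¬ Leaf u →
    ∃ λ w → OffHub u w × member sides w ≢ member sides u
  other-side-neighbour {u} u≢hub ¬leaf with member sides u in u-side
  ... | true  = let (w , r) = offHub-neighbour u≢hub ¬leaf in
                w , r , not-¬ (independent sides r u-side)
  ... | false = let (w , r , w∈I) = maximal sides u-side in
                w , r , not-¬ w∈I

  module Colouring {p k′} (leaves : HasExactly p Leaf) (p≤k : p ≤ 3 + k′) where

    side : Bool → Fin (3 + k′)
    side true = zero
    side false = suc zero

    offHubColour : Fin (3 + k′)
    offHubColour = suc (suc zero)

    side-injective : ∀ {a b} → side a ≡ side b → a ≡ b
    side-injective {true} {true} _ = refl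
    side-injective {false} {false} _ = refl

    side≢offHub : ∀ b → side b ≢ offHubColour
    side≢offHub true ()
    side≢offHub false ()

    leaf : Fin p → Fin n
    leaf = proj₁ leaves

    onto : ∀ u → Leaf u → ∃ λ i → leaf i ≡ u
    onto = proj₂ (proj₂ (proj₂ leaves))

    hue : Fin n → Fin (3 + k′)
    hue u with Leaf? u
    ... | yes u-leaf = inject≤ (proj₁ (onto u u-leaf)) p≤k
    ... | no _ = side (member sides u)

    hue-¬leaf : ∀ {u} → ¬ Leaf u → hue u ≡ side (member sides u)
    hue-¬leaf {u} ¬leaf with Leaf? u
    ... | yes u-leaf = contradiction u-leaf ¬leaf
    ... | no _ = refl

    hue-injective-on-leaves : ∀ {u v} → Leaf u → Leaf v → hue u ≡ hue v → u ≡ v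
    hue-injective-on-leaves {u} {v} u-leaf v-leaf same with Leaf? u | Leaf? v
    ... | no ¬leaf | _ = contradiction u-leaf ¬leaf
    ... | yes _ | no ¬leaf = contradiction v-leaf ¬leaf
    ... | yes u-leaf′ | yes v-leaf′
      with i , leaf-i≡u ← onto u u-leaf′ | j , leaf-j≡v ← onto v v-leaf′ =
        trans (sym leaf-i≡u) (trans (cong leaf (inject≤-injective p≤k p≤k i j same)) leaf-j≡v)

    colourBy : ∀ {a b} → Dec (a ≡ hub) → Dec (b ≡ hub) → Fin (3 + k′)
    colourBy {b = b} (yes _) _ = hue b
    colourBy {a = a} (no _) (yes _) = hue a
    colourBy (no _) (no _) = offHubColour

    colourBy-sym : ∀ {a b} (a≟hub : Dec (a ≡ hub)) (b≟hub : Dec (b ≡ hub)) →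
      colourBy a≟hub b≟hub ≡ colourBy b≟hub a≟hub
    colourBy-sym (yes refl) (yes refl) = refl
    colourBy-sym (yes _) (no _) = refl
    colourBy-sym (no _) (yes _) = refl
    colourBy-sym (no _) (no _) = refl

    colourBy-hubʳ : ∀ {a} (a≟hub : Dec (a ≡ hub)) (hub≟hub : Dec (hub ≡ hub)) → colourBy a≟hub hub≟hub ≡ hue a
    colourBy-hubʳ (yes refl) _ = refl
    colourBy-hubʳ (no _) (yes _) = refl
    colourBy-hubʳ (no _) (no hub≢hub) = contradiction refl hub≢hub

    colour : Fin n → Fin n → Fin (3 + k′)
    colour a b = colourBy (a ≟ hub) (b ≟ hub)

    colour-sym : ∀ a b → colour a b ≡ colour b a
    colour-sym a b = colourBy-sym (a ≟ hub) (b ≟ hub)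

    colour-hubʳ : ∀ a → colour a hub ≡ hue a
    colour-hubʳ a = colourBy-hubʳ (a ≟ hub) (hub ≟ hub)

    colour-hubˡ : ∀ b → colour hub b ≡ hue b
    colour-hubˡ b = trans (colour-sym hub b) (colour-hubʳ b)

    colour-offHub : ∀ {a b} → a ≢ hub → b ≢ hub → colour a b ≡ offHubColour
    colour-offHub {a} {b} a≢hub b≢hub with a ≟ hub | b ≟ hub
    ... | yes a≡hub | _ = contradiction a≡hub a≢hub
    ... | no _ | yes b≡hub = contradiction b≡hub b≢hub
    ... | no _ | no _ = refl

    edge : ∀ {u v} → Adj u v → RainbowPath Adj colour u v
    edge {u} {v} r = walk⇒rainbowPath colour (u ∷ v ∷ [])
      ((adj⇒≢ r ∷ []) ∷ [] ∷ []) (r ∷ [-]) ([] ∷ [])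

    via-hub : ∀ {u v} → u ≢ hub → v ≢ hub → u ≢ v → hue u ≢ hue v → RainbowPath Adj colour u v
    via-hub {u} {v} u≢hub v≢hub u≢v hues-differ = walk⇒rainbowPath colour (u ∷ hub ∷ v ∷ [])
      ((u≢hub ∷ u≢v ∷ []) ∷ (≢-sym v≢hub ∷ []) ∷ [] ∷ [])
      (Adj-sym (hub-dominates u u≢hub) ∷ hub-dominates v v≢hub ∷ [-])
      ((≢-resp (colour-hubʳ u) (colour-hubˡ v) hues-differ ∷ []) ∷ [] ∷ [])

    hub-then-neighbour : ∀ {u v} → ¬ Adj u v → u ≢ hub → v ≢ hub → u ≢ v → ¬ Leaf v →
      hue u ≡ hue v → RainbowPath Adj colour u v
    hub-then-neighbour {u} {v} ¬r u≢hub v≢hub u≢v ¬leaf same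
      with w , offHub@(_ , w≢hub , v~w) , other-side ← other-side-neighbour v≢hub ¬leaf =
      walk⇒rainbowPath colour (u ∷ hub ∷ w ∷ v ∷ [])
        ((u≢hub ∷ (λ { refl → ¬r (Adj-sym v~w) }) ∷ u≢v ∷ []) ∷
         (≢-sym w≢hub ∷ ≢-sym v≢hub ∷ []) ∷ (adj⇒≢ (Adj-sym v~w) ∷ []) ∷ [] ∷ [])
        (Adj-sym (hub-dominates u u≢hub) ∷ hub-dominates w w≢hub ∷ Adj-sym v~w ∷ [-])
        ((≢-resp u-hue w-hue (λ e → other-side (side-injective (sym e))) ∷
          ≢-resp u-hue (colour-offHub w≢hub v≢hub) (side≢offHub _) ∷ []) ∷
         (≢-resp w-hue (colour-offHub w≢hub v≢hub) (side≢offHub _) ∷ []) ∷ [] ∷ [])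
      where
        u-hue : colour u hub ≡ side (member sides v)
        u-hue = trans (colour-hubʳ u) (trans same (hue-¬leaf ¬leaf))
        w-hue : colour hub w ≡ side (member sides w)
        w-hue = trans (colour-hubˡ w) (hue-¬leaf (offHub⇒¬leaf offHub))

    neighbour-then-hub : ∀ {u v} → ¬ Adj u v → u ≢ hub → v ≢ hub → u ≢ v → ¬ Leaf u →
      hue u ≡ hue v → RainbowPath Adj colour u v
    neighbour-then-hub {u} {v} ¬r u≢hub v≢hub u≢v ¬leaf same
      with w , offHub@(_ , w≢hub , u~w) , other-side ← other-side-neighbour u≢hub ¬leaf =
      walk⇒rainbowPath colour (u ∷ w ∷ hub ∷ v ∷ [])
        ((adj⇒≢ u~w ∷ u≢hub ∷ u≢v ∷ []) ∷
         (w≢hub ∷ (λ { refl → ¬r u~w }) ∷ []) ∷ (≢-sym v≢hub ∷ []) ∷ [] ∷ [])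
        (u~w ∷ Adj-sym (hub-dominates w w≢hub) ∷ hub-dominates v v≢hub ∷ [-])
        ((≢-resp (colour-offHub u≢hub w≢hub) w-hue (λ e → side≢offHub _ (sym e)) ∷
          ≢-resp (colour-offHub u≢hub w≢hub) v-hue (λ e → side≢offHub _ (sym e)) ∷ []) ∷
         (≢-resp w-hue v-hue (λ e → other-side (side-injective e)) ∷ []) ∷ [] ∷ [])
      where
        w-hue : colour w hub ≡ side (member sides w)
        w-hue = trans (colour-hubʳ w) (hue-¬leaf (offHub⇒¬leaf offHub))
        v-hue : colour hub v ≡ side (member sides u)
        v-hue = trans (colour-hubˡ v) (trans (sym same) (hue-¬leaf ¬leaf))

    nonadjacent : ∀ {u v} → ¬ Adj u v → u ≢ hub → v ≢ hub → u ≢ v → RainbowPath Adj colour u v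
    nonadjacent {u} {v} ¬r u≢hub v≢hub u≢v with hue u ≟ hue v | Leaf? u | Leaf? v
    ... | no hues-differ | _ | _ = via-hub u≢hub v≢hub u≢v hues-differ
    ... | yes same | yes u-leaf | yes v-leaf =
      contradiction (hue-injective-on-leaves u-leaf v-leaf same) u≢v
    ... | yes same | _ | no ¬leaf = hub-then-neighbour ¬r u≢hub v≢hub u≢v ¬leaf same
    ... | yes same | no ¬leaf | yes _ = neighbour-then-hub ¬r u≢hub v≢hub u≢v ¬leaf same

    connected : RainbowConnected Adj colour
    connected u v u≢v with Adj? u v
    ... | yes r = edge r
    ... | no ¬r = nonadjacent ¬r (¬adj⇒≢hub u≢v ¬r) (¬adj⇒≢hub (≢-sym u≢v) (¬r ∘ Adj-sym)) u≢v

  rainbowColorable : ∀ {p k} → HasExactly p Leaf → p ≤ k → 3 ≤ k → RainbowColorable Adj k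
  rainbowColorable leaves p≤k (s≤s (s≤s (s≤s _))) = (colour , colour-sym) , connected
    where open Colouring leaves p≤k

  rcNumberIs⇔leaves : ∀ t → 4 ≤ t → RCNumberIs Adj t ⇔ HasExactly t Leaf
  rcNumberIs⇔leaves t 4≤t = mk⇔ exactlyLeaves λ leaves →
    rainbowColorable leaves ≤-refl (<⇒≤ 4≤t) ,
    λ k k<t colourable → <⇒≱ k<t (leaves≤colours leaves colourable)
    where
      exactlyLeaves : RCNumberIs Adj t → HasExactly t Leaf
      exactlyLeaves (colourable , minimal) with p , leaves ← count Leaf? =
        subst (λ q → HasExactly q Leaf) p≡t leaves
        where
          -- If p < t, then max(p, 3) < t colours would already suffice.
          p≡t : p ≡ t
          p≡t = ≤-antisym (leaves≤colours leaves colourable) (≮⇒≥ λ p<t →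
            minimal (p ⊔ 3) (⊔-lub p<t 4≤t) (rainbowColorable leaves (m≤m⊔n p 3) (m≤n⊔m p 3)))

module CommutingGraph (Γ : FiniteGroup) where
  open FiniteGroup Γ
  open IsGroup isGroup using (assoc; identityˡ; identityʳ)

  group : Group 0ℓ 0ℓ
  group = record { isGroup = isGroup }

  open GroupProperties group using (identityˡ-unique)

  CG-sym : Symmetric (CG Γ)
  CG-sym (a≢b , ab≡ba) = ≢-sym a≢b , sym ab≡ba

  ε-dominates : ∀ u → u ≢ ε → CG Γ ε u
  ε-dominates u u≢ε = ≢-sym u≢ε , trans (identityˡ u) (sym (identityʳ u))

  open Leaves (CG Γ) CG-sym ε
  open DominatingVertex (CG Γ) CG-sym (λ (a≢a , _) → a≢a refl)
    (λ a b → ¬? (a ≟ b) ×-dec (a ∙ b ≟ b ∙ a)) ε ε-dominates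
    public using (rcNumberIs⇔leaves)

  leaf⇒isolatedInvolution : ∀ {u} → Leaf u → IsolatedInvolution Γ u
  leaf⇒isolatedInvolution {u} (u≢ε , u-leaf) =
    u≢ε , square , λ b b≢ε b≢u ub≡bu → b≢ε (u-leaf b (≢-sym b≢u , ub≡bu))
    where
      square : u ∙ u ≡ ε
      square with u ≟ u ∙ u
      ... | yes u≡uu = contradiction (identityˡ-unique u u (sym u≡uu)) u≢ε
      ... | no u≢uu = u-leaf (u ∙ u) (u≢uu , sym (assoc u u u))

  isolatedInvolution⇒leaf : ∀ {u} → IsolatedInvolution Γ u → Leaf u
  isolatedInvolution⇒leaf (u≢ε , _ , isolated) =
    u≢ε , λ x (u≢x , ux≡xu) → decidable-stable (x ≟ ε) λ x≢ε → isolated x x≢ε (≢-sym u≢x) ux≡xu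

  twoLeaves⇒nonAbelian : ∀ {u v} → Leaf u → Leaf v → u ≢ v → NonAbelian Γ
  twoLeaves⇒nonAbelian u-leaf v-leaf u≢v abelian =
    leaves-nonadjacent u-leaf v-leaf (u≢v , abelian _ _)

  twoLeaves⇒trivialCenter : ∀ {u v} → Leaf u → Leaf v → u ≢ v → TrivialCenter Γ
  twoLeaves⇒trivialCenter u-leaf v-leaf u≢v z central =
    dominating≡hub u-leaf v-leaf u≢v λ x x≢z → ≢-sym x≢z , central x

corollary2 : (t : ℕ) → 4 ≤ t → (Γ : FiniteGroup) →
    RCNumberIs (CG Γ) t ⇔
      (NonAbelian Γ × TrivialCenter Γ × HasExactly t (IsolatedInvolution Γ))
corollary2 t 4≤t@(s≤s (s≤s _)) Γ = mk⇔ forward backward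
  where
    open CommutingGraph Γ
    open Equivalence (rcNumberIs⇔leaves t 4≤t)

    forward : RCNumberIs (CG Γ) t → NonAbelian Γ × TrivialCenter Γ × HasExactly t (IsolatedInvolution Γ)
    forward rc with leaves ← to rc with u , v , u-leaf , v-leaf , u≢v ← HasExactly⇒distinctPair leaves =
      twoLeaves⇒nonAbelian u-leaf v-leaf u≢v , twoLeaves⇒trivialCenter u-leaf v-leaf u≢v ,
      HasExactly-cong leaf⇒isolatedInvolution isolatedInvolution⇒leaf leaves

    backward : NonAbelian Γ × TrivialCenter Γ × HasExactly t (IsolatedInvolution Γ) → RCNumberIs (CG Γ) t
    backward (_ , _ , isolated) = from (HasExactly-cong isolatedInvolution⇒leaf leaf⇒isolatedInvolution isolated)
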